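{- The cut rule is admissible in $\mathsf{GF}$: for all finite multisets $\Gamma,\Gamma'$ of formulas and all formulas $D,E$, if $\Gamma\Rightarrow D$ and $D,\Gamma'\Rightarrow E$ are derivable in $\mathsf{GF}$, then $\Gamma,\Gamma'\Rightarrow E$ is derivable in $\mathsf{GF}$.
   Context: Formulas are built from a countable set of propositional atoms and $\bot$ using $\wedge,\vee,\rightarrow$. Sequents of $\mathsf{GF}$ have the form $\Gamma\Rightarrow C$ with $\Gamma$ a finite multiset of formulas and $C$ a formula. Rules ($p$ atomic): (Ax) $p,\Gamma\Rightarrow p$; ($\bot_L$) $\bot,\Gamma\Rightarrow C$; ($\wedge_L$) from $A,B,\Gamma\Rightarrow C$ infer $A\wedge B,\Gamma\Rightarrow C$; ($\wedge_R$) from $\Gamma\Rightarrow A$ and $\Gamma\Rightarrow B$ infer $\Gamma\Rightarrow A\wedge B$; ($\vee_L$) from $A,\Gamma\Rightarrow C$ and $B,\Gamma\Rightarrow C$ infer $A\vee B,\Gamma\Rightarrow C$; ($\vee_R^1$) from $\Gamma\Rightarrow A$ infer $\Gamma\Rightarrow A\vee B$; ($\vee_R^2$) from $\Gamma\Rightarrow B$ infer $\Gamma\Rightarrow A\vee B$; ($\rightarrow_R$) from $A\Rightarrow B$ infer $\Gamma\Rightarrow A\rightarrow B$; ($\rightarrow_{LR}$) from $A\Rightarrow B$, $B\Rightarrow A$, $C\Rightarrow D$, $D\Rightarrow C$ infer $\Gamma,A\rightarrow C\Rightarrow B\rightarrow D$; ($\rightarrow_I$) from $\Gamma\Rightarrow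 B\rightarrow C$ and $\Gamma\Rightarrow C\rightarrow D$ infer $\Gamma\Rightarrow B\rightarrow D$; ($\rightarrow_C$) from $\Gamma\Rightarrow B\rightarrow C$ and $\Gamma\Rightarrow B\rightarrow D$ infer $\Gamma\Rightarrow B\rightarrow C\wedge D$; ($\rightarrow_D$) from $\Gamma\Rightarrow B\rightarrow C$ and $\Gamma\Rightarrow D\rightarrow C$ infer $\Gamma\Rightarrow B\vee D\rightarrow C$. Derivability uses only these rules, without cut. -}

module Defs where

open import Data.Nat using (ℕ)
open import Data.List using (List; []; _∷_; [_]; _++_)
open import Data.List.Relation.Binary.Permutation.Propositional using (_↭_)

data Formula : Set where
  atom : ℕ → Formula
  ⊥'   : Formula
  _∧'_ : Formula → Formula → Formula
  _∨'_ : Formula → Formula → Formula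
  _⇒'_ : Formula → Formula → Formula

infixr 6 _∧'_
infixr 5 _∨'_
infixr 4 _⇒'_

-- Antecedents are finite multisets, represented by lists taken up to
-- permutation: every rule locates its principal formula(s) in the
-- antecedent Γ via a permutation Γ ↭ (principal ∷ rest), so derivability
-- depends only on the underlying multiset.
infix 2 GF_⊢_
data GF_⊢_ : List Formula → Formula → Set where
  ax   : ∀ {Γ Δ} p → Γ ↭ (atom p ∷ Δ) → GF Γ ⊢ atom p
  ⊥L   : ∀ {Γ Δ C} → Γ ↭ (⊥' ∷ Δ) → GF Γ ⊢ C
  ∧L   : ∀ {Γ Δ A B C} → Γ ↭ ((A ∧' B) ∷ Δ) →
         GF (A ∷ B ∷ Δ) ⊢ C → GF Γ ⊢ C
  ∧R   : ∀ {Γ A B} → GF Γ ⊢ A → GF Γ ⊢ B → GF Γ ⊢ A ∧' B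
  ∨L   : ∀ {Γ Δ A B C} → Γ ↭ ((A ∨' B) ∷ Δ) →
         GF (A ∷ Δ) ⊢ C → GF (B ∷ Δ) ⊢ C → GF Γ ⊢ C
  ∨R₁  : ∀ {Γ A B} → GF Γ ⊢ A → GF Γ ⊢ A ∨' B
  ∨R₂  : ∀ {Γ A B} → GF Γ ⊢ B → GF Γ ⊢ A ∨' B
  ⇒R   : ∀ {Γ A B} → GF [ A ] ⊢ B → GF Γ ⊢ A ⇒' B
  ⇒LR  : ∀ {Γ Δ A B C D} → Γ ↭ ((A ⇒' C) ∷ Δ) →
         GF [ A ] ⊢ B → GF [ B ] ⊢ A → GF [ C ] ⊢ D → GF [ D ] ⊢ C →
         GF Γ ⊢ B ⇒' D
  ⇒I   : ∀ {Γ B C D} → GF Γ ⊢ B ⇒' C → GF Γ ⊢ C ⇒' D → GF Γ ⊢ B ⇒' D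
  ⇒C   : ∀ {Γ B C D} → GF Γ ⊢ B ⇒' C → GF Γ ⊢ B ⇒' D → GF Γ ⊢ B ⇒' (C ∧' D)
  ⇒D   : ∀ {Γ B C D} → GF Γ ⊢ B ⇒' C → GF Γ ⊢ D ⇒' C → GF Γ ⊢ (B ∨' D) ⇒' C

{-# OPTIONS --safe #-}
-- A left rule acting on a formula other than D commutes with every
-- operation that replaces D in the antecedent, so such an operation is
-- admissible as soon as it is admissible when D is principal.  This gives
-- invertibility of ∧L and ∨L, and reduces cut to principal cuts.  The cut
-- proved is the context-sharing one (Γ ⇒ D and D, Γ ⇒ E give Γ ⇒ E), which
-- needs no contraction: the principal ∧ case cuts twice against the same Γ.
-- It goes by induction on D and then on the derivation of Γ ⇒ D, whose left
-- rules are moved below the cut by inverting D, Γ ⇒ E.  The multiplicative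
-- cut of the theorem then follows by weakening.
module Submission where

open import Defs
open import Data.List using (List; []; _∷_; [_]; _++_)
open import Data.Unit using (⊤; tt)
open import Data.Product using (_,_)
open import Relation.Binary.PropositionalEquality using (_≡_; refl)
open import Data.List.Relation.Unary.Any using (here; there)
open import Data.List.Membership.Propositional.Properties using (∈-∃++)
open import Data.List.Relation.Binary.Permutation.Propositional
  using (_↭_; prep; swap; ↭-refl; ↭-sym; ↭-trans)
open import Data.List.Relation.Binary.Permutation.Propositional.Properties
  using (shift; ++⁺ʳ; ++-comm; ++-identityʳ; drop-∷; ∈-resp-↭)

private
  variable
    Γ Δ Θ : List Formula
    A B C D E X : Formula

⊢-resp-↭ : Γ ↭ Δ → GF Γ ⊢ C → GF Δ ⊢ C
⊢-resp-↭ ρ (ax p π)          = ax p (↭-trans (↭-sym ρ) π)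
⊢-resp-↭ ρ (⊥L π)            = ⊥L (↭-trans (↭-sym ρ) π)
⊢-resp-↭ ρ (∧L π d)          = ∧L (↭-trans (↭-sym ρ) π) d
⊢-resp-↭ ρ (∨L π d₁ d₂)      = ∨L (↭-trans (↭-sym ρ) π) d₁ d₂
⊢-resp-↭ ρ (⇒LR π a b c d)   = ⇒LR (↭-trans (↭-sym ρ) π) a b c d
⊢-resp-↭ ρ (∧R a b)          = ∧R (⊢-resp-↭ ρ a) (⊢-resp-↭ ρ b)
⊢-resp-↭ ρ (∨R₁ a)           = ∨R₁ (⊢-resp-↭ ρ a)
⊢-resp-↭ ρ (∨R₂ b)           = ∨R₂ (⊢-resp-↭ ρ b)
⊢-resp-↭ ρ (⇒R d)            = ⇒R d
⊢-resp-↭ ρ (⇒I a b)          = ⇒I (⊢-resp-↭ ρ a) (⊢-resp-↭ ρ b)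
⊢-resp-↭ ρ (⇒C a b)          = ⇒C (⊢-resp-↭ ρ a) (⊢-resp-↭ ρ b)
⊢-resp-↭ ρ (⇒D a b)          = ⇒D (⊢-resp-↭ ρ a) (⊢-resp-↭ ρ b)

weaken : ∀ Δ → GF Γ ⊢ C → GF (Γ ++ Δ) ⊢ C
weaken Δ (ax p π)          = ax p (++⁺ʳ Δ π)
weaken Δ (⊥L π)            = ⊥L (++⁺ʳ Δ π)
weaken Δ (∧L π d)          = ∧L (++⁺ʳ Δ π) (weaken Δ d)
weaken Δ (∨L π d₁ d₂)      = ∨L (++⁺ʳ Δ π) (weaken Δ d₁) (weaken Δ d₂)
weaken Δ (⇒LR π a b c d)   = ⇒LR (++⁺ʳ Δ π) a b c d
weaken Δ (∧R a b)          = ∧R (weaken Δ a) (weaken Δ b)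
weaken Δ (∨R₁ a)           = ∨R₁ (weaken Δ a)
weaken Δ (∨R₂ b)           = ∨R₂ (weaken Δ b)
weaken Δ (⇒R d)            = ⇒R d
weaken Δ (⇒I a b)          = ⇒I (weaken Δ a) (weaken Δ b)
weaken Δ (⇒C a b)          = ⇒C (weaken Δ a) (weaken Δ b)
weaken Δ (⇒D a b)          = ⇒D (weaken Δ a) (weaken Δ b)

weaken-∷ : ∀ A → GF Γ ⊢ C → GF (A ∷ Γ) ⊢ C
weaken-∷ {Γ} A d = ⊢-resp-↭ (++-comm Γ [ A ]) (weaken [ A ] d)

∷-↭-swap : ∀ D → Γ ↭ X ∷ Δ → D ∷ Γ ↭ X ∷ D ∷ Δ
∷-↭-swap D π = ↭-trans (prep D π) (swap D _ ↭-refl)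

data Located (D X : Formula) (Γ Δ : List Formula) : Set where
  same  : X ≡ D → Δ ↭ Γ → Located D X Γ Δ
  other : ∀ Δ′ → Γ ↭ X ∷ Δ′ → Δ ↭ D ∷ Δ′ → Located D X Γ Δ

locate : Θ ↭ D ∷ Γ → Θ ↭ X ∷ Δ → Located D X Γ Δ
locate σ π = located (↭-trans (↭-sym π) σ)
  where
  located : X ∷ Δ ↭ D ∷ Γ → Located D X Γ Δ
  located {X = X} {D = D} ρ with ∈-resp-↭ ρ (here refl)
  ... | here refl = same refl (drop-∷ ρ)
  ... | there X∈Γ with ∈-∃++ X∈Γ
  ... | Γ₁ , Γ₂ , refl =
    other (Γ₁ ++ Γ₂) (shift X Γ₁ Γ₂) (drop-∷ (↭-trans ρ (∷-↭-swap D (shift X Γ₁ Γ₂))))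

data LeftPrincipal : Formula → List Formula → Formula → Set where
  ax  : ∀ {p} → LeftPrincipal (atom p) Γ (atom p)
  ⊥L  : LeftPrincipal ⊥' Γ C
  ∧L  : GF (A ∷ B ∷ Γ) ⊢ C → LeftPrincipal (A ∧' B) Γ C
  ∨L  : GF (A ∷ Γ) ⊢ C → GF (B ∷ Γ) ⊢ C → LeftPrincipal (A ∨' B) Γ C
  ⇒LR : GF [ A ] ⊢ B → GF [ B ] ⊢ A → GF [ C ] ⊢ D → GF [ D ] ⊢ C →
        LeftPrincipal (A ⇒' C) Γ (B ⇒' D)

record Replacement (D : Formula) (Σ : List Formula)
                   (P : List Formula → Set) : Set where
  field
    ∧-stable  : Γ ↭ (A ∧' B) ∷ Δ → P Γ → P (A ∷ B ∷ Δ)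
    ∨-stableˡ : Γ ↭ (A ∨' B) ∷ Δ → P Γ → P (A ∷ Δ)
    ∨-stableʳ : Γ ↭ (A ∨' B) ∷ Δ → P Γ → P (B ∷ Δ)
    principal : P Γ → LeftPrincipal D Γ E → GF (Γ ++ Σ) ⊢ E

open Replacement

replace : ∀ {Σ P} → Replacement D Σ P →
          GF Θ ⊢ E → Θ ↭ D ∷ Γ → P Γ → GF (Γ ++ Σ) ⊢ E
replace R (ax p π) σ h with locate σ π
... | same refl _    = principal R h ax
... | other _ γ _    = ax p (++⁺ʳ _ γ)
replace R (⊥L π) σ h with locate σ π
... | same refl _    = principal R h ⊥L
... | other _ γ _    = ⊥L (++⁺ʳ _ γ)
replace R (∧L π d) σ h with locate σ π
... | same refl δ    = principal R h (∧L (⊢-resp-↭ (prep _ (prep _ δ)) d))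
... | other Δ γ δ    =
  ∧L (++⁺ʳ _ γ)
     (replace R d (↭-trans (prep _ (prep _ δ)) (shift _ (_ ∷ _ ∷ []) Δ)) (∧-stable R γ h))
replace R (∨L π d₁ d₂) σ h with locate σ π
... | same refl δ    = principal R h (∨L (⊢-resp-↭ (prep _ δ) d₁) (⊢-resp-↭ (prep _ δ) d₂))
... | other Δ γ δ    =
  ∨L (++⁺ʳ _ γ)
     (replace R d₁ (↭-trans (prep _ δ) (swap _ _ ↭-refl)) (∨-stableˡ R γ h))
     (replace R d₂ (↭-trans (prep _ δ) (swap _ _ ↭-refl)) (∨-stableʳ R γ h))
replace R (⇒LR π a b c d) σ h with locate σ π
... | same refl _    = principal R h (⇒LR a b c d)
... | other _ γ _    = ⇒LR (++⁺ʳ _ γ) a b c d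
replace R (∧R a b) σ h = ∧R (replace R a σ h) (replace R b σ h)
replace R (∨R₁ a) σ h  = ∨R₁ (replace R a σ h)
replace R (∨R₂ b) σ h  = ∨R₂ (replace R b σ h)
replace R (⇒R d) σ h   = ⇒R d
replace R (⇒I a b) σ h = ⇒I (replace R a σ h) (replace R b σ h)
replace R (⇒C a b) σ h = ⇒C (replace R a σ h) (replace R b σ h)
replace R (⇒D a b) σ h = ⇒D (replace R a σ h) (replace R b σ h)

invert : ∀ Σ → (∀ {Γ E} → LeftPrincipal D Γ E → GF (Σ ++ Γ) ⊢ E) →
         GF Θ ⊢ E → Θ ↭ D ∷ Γ → GF (Σ ++ Γ) ⊢ E
invert {Γ = Γ} Σ inv d σ = ⊢-resp-↭ (++-comm Γ Σ) (replace R d σ tt)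
  where
  R : Replacement _ Σ (λ _ → ⊤)
  R = record
    { ∧-stable  = λ _ _ → tt
    ; ∨-stableˡ = λ _ _ → tt
    ; ∨-stableʳ = λ _ _ → tt
    ; principal = λ {Γ′} _ l → ⊢-resp-↭ (++-comm Σ Γ′) (inv l)
    }

∧L-inversion : GF Θ ⊢ E → Θ ↭ (A ∧' B) ∷ Γ → GF (A ∷ B ∷ Γ) ⊢ E
∧L-inversion {A = A} {B} = invert (A ∷ B ∷ []) λ { (∧L d) → d }

∨L-inversionˡ : GF Θ ⊢ E → Θ ↭ (A ∨' B) ∷ Γ → GF (A ∷ Γ) ⊢ E
∨L-inversionˡ {A = A} = invert [ A ] λ { (∨L d₁ _) → d₁ }

∨L-inversionʳ : GF Θ ⊢ E → Θ ↭ (A ∨' B) ∷ Γ → GF (B ∷ Γ) ⊢ E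
∨L-inversionʳ {B = B} = invert [ B ] λ { (∨L _ d₂) → d₂ }

-- What a principal cut needs from the left premise.  An atom is principal
-- on the right only in ax, and the principal ⇒ case is settled by ⇒I alone,
-- so for these any derivation will do.
data Canonical (Γ : List Formula) : Formula → Set where
  atomic      : ∀ {p} → GF Γ ⊢ atom p → Canonical Γ (atom p)
  ∧R          : GF Γ ⊢ A → GF Γ ⊢ B → Canonical Γ (A ∧' B)
  ∨R₁         : GF Γ ⊢ A → Canonical Γ (A ∨' B)
  ∨R₂         : GF Γ ⊢ B → Canonical Γ (A ∨' B)
  implication : GF Γ ⊢ A ⇒' B → Canonical Γ (A ⇒' B)

Canonical-map : (∀ {C} → GF Γ ⊢ C → GF Δ ⊢ C) → Canonical Γ D → Canonical Δ D
Canonical-map f (atomic d)      = atomic (f d)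
Canonical-map f (∧R a b)        = ∧R (f a) (f b)
Canonical-map f (∨R₁ a)         = ∨R₁ (f a)
Canonical-map f (∨R₂ b)         = ∨R₂ (f b)
Canonical-map f (implication d) = implication (f d)

mutual
  cut : GF Γ ⊢ D → GF (D ∷ Γ) ⊢ E → GF Γ ⊢ E
  cut {D = atom p} d e = cut-canonical (atomic d) e
  cut {D = _ ⇒' _} d e = cut-canonical (implication d) e
  cut (⊥L π) e         = ⊥L π
  cut {D = D} (∧L {A = A} {B = B} π d) e =
    ∧L π (cut d (⊢-resp-↭ (shift D (A ∷ B ∷ []) _) (∧L-inversion e (∷-↭-swap D π))))
  cut {D = D} (∨L {A = A} {B = B} π d₁ d₂) e =
    ∨L π (cut d₁ (⊢-resp-↭ (swap A D ↭-refl) (∨L-inversionˡ e (∷-↭-swap D π))))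
         (cut d₂ (⊢-resp-↭ (swap B D ↭-refl) (∨L-inversionʳ e (∷-↭-swap D π))))
  cut (∧R a b) e       = cut-canonical (∧R a b) e
  cut (∨R₁ a) e        = cut-canonical (∨R₁ a) e
  cut (∨R₂ b) e        = cut-canonical (∨R₂ b) e

  cut-canonical : Canonical Γ D → GF (D ∷ Γ) ⊢ E → GF Γ ⊢ E
  cut-canonical {Γ} c e = ⊢-resp-↭ (++-identityʳ Γ) (replace R e ↭-refl c)
    where
    R : Replacement _ [] (λ Γ → Canonical Γ _)
    R = record
      { ∧-stable  = λ π → Canonical-map λ d → ∧L-inversion d π
      ; ∨-stableˡ = λ π → Canonical-map λ d → ∨L-inversionˡ d π
      ; ∨-stableʳ = λ π → Canonical-map λ d → ∨L-inversionʳ d π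
      ; principal = λ {Γ′} c l → ⊢-resp-↭ (↭-sym (++-identityʳ Γ′)) (principal-cut c l)
      }

  principal-cut : Canonical Γ D → LeftPrincipal D Γ E → GF Γ ⊢ E
  principal-cut (atomic d) ax           = d
  principal-cut (∧R {A = A} a b) (∧L d) =
    cut a (cut (weaken-∷ A b) (⊢-resp-↭ (swap A _ ↭-refl) d))
  principal-cut (∨R₁ a) (∨L d₁ _)       = cut a d₁
  principal-cut (∨R₂ b) (∨L _ d₂)       = cut b d₂
  principal-cut (implication d) (⇒LR _ b⊢a c⊢d _) = ⇒I (⇒I (⇒R b⊢a) d) (⇒R c⊢d)

mainTheorem15 : (Γ Γ′ : List Formula) (D E : Formula) →
    GF Γ ⊢ D → GF (D ∷ Γ′) ⊢ E → GF (Γ ++ Γ′) ⊢ E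
mainTheorem15 Γ Γ′ D E d e =
  cut (weaken Γ′ d) (⊢-resp-↭ (prep D (++-comm Γ′ Γ)) (weaken Γ e))
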